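{- Run the following algorithm: set $T=\max_{e\in E}r_e+\lambda\max_{e\in E}D_e$; for $t=1,\dots,T$: let $O'$ be the subgraph of the current $O$ induced by the vertices $e$ with $t>r_e$, choose a kernel $U$ of $O'$, schedule every $e\in U$ in time slot $t$, and remove $U$ from $O$. Then the algorithm is well defined and produces a feasible edge schedule on $G$ — every hyperedge $e$ is scheduled in exactly one slot $t>r_e$, and the hyperedges scheduled in any single slot are pairwise disjoint — in which every hyperedge $e$ is scheduled not later than $r_e+\lambda D_e$.
   Context: Let $G=(V,E)$ be a hypergraph (possibly with repeated hyperedges, treated as distinct) with $|e|\le\lambda$ for all $e\in E$, where each hyperedge $e$ has a release time $r_e\in\mathbb{Z}_{\ge0}$ and a deadline $D_e$. The line graph $L(G)$ has vertex set $E$ and an edge between two distinct hyperedges iff they share a node. Index the hyperedges $e_1,\dots,e_N$ so that $D_{e_1}\le\dots\le D_{e_N}$, and let $O$ be the orientation of $L(G)$ orienting each edge $\{e_i,e_j\}$ with $i>j$ as the arc $(e_i,e_j)$. Assume $|d^+(e)|\le\lambda(D_e-1)$ for all $e$, where $d^+(e)$ is the set of arcs of $O$ leaving $e$. (In the paper this is the orientation built from a Path-based Coflow Scheduling instance with deadlines derived from an LP.) A kernel of a digraph is an independent set $U$ of vertices such that every vertex not in $U$ has an arc to some vertex of $U$; "remove $U$ from $O$" deletes these vertices and their incident arcs. -}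

module Defs where

open import Data.Nat using (ℕ; zero; suc; pred; _+_; _*_; _≤_; _<_; _⊔_)
open import Data.Nat.Properties using (_<?_)
open import Data.Bool using (Bool; true; false; _∧_)
open import Data.Fin using (Fin; toℕ)
open import Data.Fin.Subset using (Subset; _∈_; _∉_; _∩_; ∁; ⊤; ∣_∣; Nonempty; Empty)
open import Data.Fin.Subset.Properties using (nonempty?)
open import Data.Vec using (tabulate; foldr)
open import Data.Product using (Σ; _×_)
open import Relation.Nullary using (¬_)
open import Relation.Nullary.Decidable using (⌊_⌋)

-- A hypergraph on node set Fin n with N hyperedges (indexed e_0..e_{N-1},
-- repeated hyperedges allowed since they are distinct indices); each
-- hyperedge is a subset of the nodes.
Hypergraph : ℕ → ℕ → Set
Hypergraph n N = Fin N → Subset n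

Shares : ∀ {n N} → Hypergraph n N → Fin N → Fin N → Set
Shares E i j = Nonempty (E i ∩ E j)

-- Arc of the orientation O of the line graph L(G): (e_i , e_j) for i > j
-- and e_i , e_j sharing a node (distinctness is implied by j < i).
Arc : ∀ {n N} → Hypergraph n N → Fin N → Fin N → Set
Arc E i j = (toℕ j < toℕ i) × Shares E i j

outNbrs : ∀ {n N} → Hypergraph n N → Fin N → Subset N
outNbrs E i = tabulate (λ j → ⌊ toℕ j <? toℕ i ⌋ ∧ ⌊ nonempty? (E i ∩ E j) ⌋)

outdeg : ∀ {n N} → Hypergraph n N → Fin N → ℕ
outdeg E i = ∣ outNbrs E i ∣

-- maximum of a function over Fin N (0 if N = 0)
maxF : ∀ {N} → (Fin N → ℕ) → ℕ
maxF f = foldr (λ _ → ℕ) _⊔_ 0 (tabulate f)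

IsKernel : ∀ {n N} → Hypergraph n N → Subset N → Subset N → Set
IsKernel {n} {N} E A U =
  (∀ i → i ∈ U → i ∈ A) ×
  (∀ i j → i ∈ U → j ∈ U → ¬ Arc E i j) ×
  (∀ i → i ∈ A → i ∉ U → Σ (Fin N) (λ j → j ∈ U × Arc E i j))

released : ∀ {N} → (Fin N → ℕ) → ℕ → Subset N
released r t = tabulate (λ e → ⌊ r e <? t ⌋)

-- Given the kernels U t chosen at slots t = 1,2,..., the hyperedges still
-- present in O after slots 1..k.
Remaining : ∀ {N} → (ℕ → Subset N) → ℕ → Subset N
Remaining U zero = ⊤
Remaining U (suc k) = Remaining U k ∩ ∁ (U (suc k))

Available : ∀ {N} → (Fin N → ℕ) → (ℕ → Subset N) → ℕ → Subset N
Available r U t = Remaining U (pred t) ∩ released r t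

ValidRunUpTo : ∀ {n N} → Hypergraph n N → (Fin N → ℕ) → (ℕ → Subset N) → ℕ → Set
ValidRunUpTo E r U k = ∀ t → 1 ≤ t → t ≤ k → IsKernel E (Available r U t) (U t)

-- The orientation O of the line graph only has arcs from a hyperedge to
-- hyperedges of smaller index.
--
--  * Kernels exist.  For any relation R whose arcs strictly decrease the
--    index, every vertex set A has a kernel: scan the vertices in index
--    order and add a vertex of A exactly when it has no arc into the part
--    of the kernel already built.  This makes the algorithm well defined.
--  * Feasibility.  Each chosen set lies in the current vertex set, so a
--    hyperedge chosen once is removed and never chosen again; a chosen set
--    is independent, so the hyperedges of one slot are pairwise disjoint.
--  * Deadline.  While a released hyperedge e is not scheduled, the kernel
--    of each slot contains one of its out-neighbours, which is then
--    removed.  So after m waiting slots at most |d⁺(e)| − m out-neighbours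
--    remain; since |d⁺(e)| < λ D_e, hyperedge e is scheduled within λ D_e
--    slots after its release, and r_e + λ D_e ≤ T.
--
-- Only the degree hypothesis |d⁺(e)| + λ ≤ λ D_e (with λ ≥ 1) is used; the
-- bound on the hyperedge sizes and the ordering of the deadlines enter the
-- paper only through the construction of that hypothesis.
module Submission where

open import Defs
open import Data.Nat using (ℕ; _+_; _*_; _≤_; _<_)
open import Data.Fin using (Fin; toℕ)
open import Data.Fin.Subset using (Subset; _∈_; _∩_; ∣_∣; Empty)
open import Data.Product using (Σ; _×_)
open import Relation.Binary.PropositionalEquality using (_≡_; _≢_)

open import Data.Bool using (Bool; true; _∧_)
open import Data.Nat using (suc; pred; z≤n; s≤s; _<?_; anyUpTo?)
open import Data.Nat.Properties
open import Data.Fin using (zero; suc; fromℕ<)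
open import Data.Fin.Properties using (toℕ-injective; toℕ<n; toℕ-fromℕ<; any?)
open import Data.Fin.Subset using (_∉_; _⊆_; _∪_; ⁅_⁆; ⊥)
open import Data.Fin.Subset.Properties
  using (_∈?_; nonempty?; ∉⊥; ∈⊤; x∈p∩q⁺; x∈p∩q⁻; ∩-comm; x∈∁p⇒x∉p; x∉p⇒x∈∁p;
         ∣p∩q∣≤∣p∣; p⊂q⇒∣p∣<∣q∣; p⊆p∪q; q⊆p∪q; x∈p∪q⁻; x∈⁅x⁆; x∈⁅y⁆⇒x≡y)
open import Data.Vec using (tabulate)
open import Data.Vec.Properties using (lookup∘tabulate; []=⇒lookup; lookup⇒[]=)
open import Data.Product using (_,_; proj₁; proj₂; ∃)
open import Data.Sum using (_⊎_; inj₁; inj₂)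
open import Data.Empty using (⊥-elim)
open import Relation.Binary using (tri<; tri≈; tri>)
open import Relation.Nullary using (¬_; Dec; yes; no)
open import Relation.Nullary.Decidable using (⌊_⌋; _×-dec_; isYes≗does; dec-true)
open import Relation.Binary.PropositionalEquality using (refl; sym; trans; subst; cong₂)

∈-tabulate⁻ : ∀ {N} (f : Fin N → Bool) i → i ∈ tabulate f → f i ≡ true
∈-tabulate⁻ f i i∈ = trans (sym (lookup∘tabulate f i)) ([]=⇒lookup i∈)

∈-tabulate⁺ : ∀ {N} (f : Fin N → Bool) i → f i ≡ true → i ∈ tabulate f
∈-tabulate⁺ f i fi = lookup⇒[]= i _ (trans (lookup∘tabulate f i) fi)

⌊⌋-sound : ∀ {P : Set} (d : Dec P) → ⌊ d ⌋ ≡ true → P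
⌊⌋-sound (yes p) _ = p

⌊⌋-complete : ∀ {P : Set} (d : Dec P) → P → ⌊ d ⌋ ≡ true
⌊⌋-complete d p = trans (isYes≗does d) (dec-true d p)

released⁻ : ∀ {N} (r : Fin N → ℕ) t e → e ∈ released r t → r e < t
released⁻ r t e e∈ = ⌊⌋-sound (r e <? t) (∈-tabulate⁻ _ e e∈)

released⁺ : ∀ {N} (r : Fin N → ℕ) t e → r e < t → e ∈ released r t
released⁺ r t e re<t = ∈-tabulate⁺ _ e (⌊⌋-complete (r e <? t) re<t)

f≤maxF : ∀ {N} (f : Fin N → ℕ) (i : Fin N) → f i ≤ maxF f
f≤maxF f zero    = m≤m⊔n _ _
f≤maxF f (suc i) = ≤-trans (f≤maxF (λ j → f (suc j)) i) (m≤n⊔m (f zero) _)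

module DescendingKernel {N : ℕ} (R : Fin N → Fin N → Set)
    (R? : ∀ i j → Dec (R i j)) (descending : ∀ {i j} → R i j → toℕ j < toℕ i)
    (A : Subset N) where

  Independent : Subset N → Set
  Independent K = ∀ i j → i ∈ K → j ∈ K → ¬ R i j

  DominatesBelow : ℕ → Subset N → Set
  DominatesBelow m K =
    ∀ i → i ∈ A → toℕ i < m → i ∉ K → Σ (Fin N) (λ j → j ∈ K × R i j)

  KernelBelow : ℕ → Subset N → Set
  KernelBelow m K =
    (∀ i → i ∈ K → i ∈ A) × (∀ i → i ∈ K → toℕ i < m) ×
    Independent K × DominatesBelow m K

  Kernel : Subset N → Set
  Kernel K = (∀ i → i ∈ K → i ∈ A) × Independent K ×
    (∀ i → i ∈ A → i ∉ K → Σ (Fin N) (λ j → j ∈ K × R i j))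

  kernelBelow-zero : KernelBelow 0 ⊥
  kernelBelow-zero =
    (λ i i∈ → ⊥-elim (∉⊥ i∈)) , (λ i i∈ → ⊥-elim (∉⊥ i∈)) ,
    (λ i j i∈ → ⊥-elim (∉⊥ i∈)) , (λ _ _ i<0 _ → ⊥-elim (n≮0 i<0))

  below-suc : ∀ {m} (v : Fin N) → toℕ v ≡ m → ∀ i → toℕ i < suc m →
              toℕ i < m ⊎ i ≡ v
  below-suc v v≡m i i<1+m with m<1+n⇒m<n∨m≡n i<1+m
  ... | inj₁ i<m = inj₁ i<m
  ... | inj₂ i≡m = inj₂ (toℕ-injective (trans i≡m (sym v≡m)))

  keep : ∀ {m K} (v : Fin N) → toℕ v ≡ m → KernelBelow m K →
         (v ∈ A → ∃ λ j → j ∈ K × R v j) → KernelBelow (suc m) K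
  keep v v≡m (K⊆A , K<m , indep , dom) v-dominated =
    K⊆A , (λ i i∈ → m≤n⇒m≤1+n (K<m i i∈)) , indep , dom′
    where
    dom′ : DominatesBelow _ _
    dom′ i i∈A i<1+m i∉K with below-suc v v≡m i i<1+m
    ... | inj₁ i<m  = dom i i∈A i<m i∉K
    ... | inj₂ refl = v-dominated i∈A

  -- Extension, second case: otherwise v is added; it has no arc into K by assumption, and
  -- no vertex of K has an arc to v since K lies below v.
  add : ∀ {m K} (v : Fin N) → toℕ v ≡ m → KernelBelow m K → v ∈ A →
        ¬ (∃ λ j → j ∈ K × R v j) → KernelBelow (suc m) (K ∪ ⁅ v ⁆)
  add {m} {K} v v≡m (K⊆A , K<m , indep , dom) v∈A v-free =
    K′⊆A , K′<1+m , indep′ , dom′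
    where
    K′ = K ∪ ⁅ v ⁆
    old-or-new : ∀ i → i ∈ K′ → i ∈ K ⊎ i ≡ v
    old-or-new i i∈ with x∈p∪q⁻ K ⁅ v ⁆ i∈
    ... | inj₁ i∈K = inj₁ i∈K
    ... | inj₂ i∈v = inj₂ (x∈⁅y⁆⇒x≡y v i∈v)
    K′⊆A : ∀ i → i ∈ K′ → i ∈ A
    K′⊆A i i∈ with old-or-new i i∈
    ... | inj₁ i∈K = K⊆A i i∈K
    ... | inj₂ refl = v∈A
    K′<1+m : ∀ i → i ∈ K′ → toℕ i < suc m
    K′<1+m i i∈ with old-or-new i i∈
    ... | inj₁ i∈K = m≤n⇒m≤1+n (K<m i i∈K)
    ... | inj₂ refl = s≤s (≤-reflexive v≡m)
    indep′ : Independent K′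
    indep′ i j i∈ j∈ with old-or-new i i∈ | old-or-new j j∈
    ... | inj₁ i∈K | inj₁ j∈K = indep i j i∈K j∈K
    ... | inj₂ refl | inj₁ j∈K = λ Rvj → v-free (j , j∈K , Rvj)
    ... | inj₁ i∈K | inj₂ refl =
      λ Riv → <-asym (descending Riv) (subst (toℕ i <_) (sym v≡m) (K<m i i∈K))
    ... | inj₂ refl | inj₂ refl = λ Rvv → <-irrefl refl (descending Rvv)
    dom′ : DominatesBelow (suc m) K′
    dom′ i i∈A i<1+m i∉K′ with below-suc v v≡m i i<1+m
    ... | inj₂ refl = ⊥-elim (i∉K′ (q⊆p∪q K ⁅ v ⁆ (x∈⁅x⁆ v)))
    ... | inj₁ i<m with dom i i∈A i<m (λ i∈K → i∉K′ (p⊆p∪q ⁅ v ⁆ i∈K))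
    ... | j , j∈K , Rij = j , p⊆p∪q ⁅ v ⁆ j∈K , Rij

  kernelBelow : ∀ m → m ≤ N → Σ (Subset N) (KernelBelow m)
  kernelBelow 0       _   = ⊥ , kernelBelow-zero
  kernelBelow (suc m) m<N with kernelBelow m (<⇒≤ m<N)
  ... | K , kerK with v ∈? A | any? (λ j → (j ∈? K) ×-dec R? v j)
    where v = fromℕ< m<N
  ... | no v∉A   | _        = K , keep _ (toℕ-fromℕ< m<N) kerK (λ v∈A → ⊥-elim (v∉A v∈A))
  ... | yes _    | yes arc  = K , keep _ (toℕ-fromℕ< m<N) kerK (λ _ → arc)
  ... | yes v∈A  | no ¬arc  = _ , add _ (toℕ-fromℕ< m<N) kerK v∈A ¬arc

  kernel : Σ (Subset N) Kernel
  kernel with kernelBelow N ≤-refl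
  ... | K , K⊆A , _ , indep , dom = K , K⊆A , indep , λ i i∈A → dom i i∈A (toℕ<n i)

Arc? : ∀ {n N} (E : Hypergraph n N) i j → Dec (Arc E i j)
Arc? E i j = (toℕ j <? toℕ i) ×-dec nonempty? (E i ∩ E j)

arc⇒outNbr : ∀ {n N} (E : Hypergraph n N) i j → Arc E i j → j ∈ outNbrs E i
arc⇒outNbr E i j (j<i , shared) = ∈-tabulate⁺ _ j
  (cong₂ _∧_ (⌊⌋-complete (toℕ j <? toℕ i) j<i) (⌊⌋-complete (nonempty? (E i ∩ E j)) shared))

kernelExists : ∀ {n N} (E : Hypergraph n N) (A : Subset N) →
               Σ (Subset N) (IsKernel E A)
kernelExists E = DescendingKernel.kernel (Arc E) (Arc? E) proj₁

Unscheduled : ∀ {N} → (ℕ → Subset N) → Fin N → ℕ → Set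
Unscheduled U e k = ∀ s → 1 ≤ s → s ≤ k → e ∉ U s

remaining⇒unscheduled : ∀ {N} (U : ℕ → Subset N) e k →
                        e ∈ Remaining U k → Unscheduled U e k
remaining⇒unscheduled U e 0       _  s 1≤s s≤0 = ⊥-elim (<⇒≱ 1≤s s≤0)
remaining⇒unscheduled U e (suc k) e∈ s 1≤s s≤1+k with x∈p∩q⁻ (Remaining U k) _ e∈
... | e∈Rk , e∉Uk+1 with m≤n⇒m<n∨m≡n s≤1+k
... | inj₁ s≤k  = remaining⇒unscheduled U e k e∈Rk s 1≤s (≤-pred s≤k)
... | inj₂ refl = x∈∁p⇒x∉p e∉Uk+1

unscheduled⇒remaining : ∀ {N} (U : ℕ → Subset N) e k →
                        Unscheduled U e k → e ∈ Remaining U k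
unscheduled⇒remaining U e 0       _     = ∈⊤
unscheduled⇒remaining U e (suc k) unsch = x∈p∩q⁺
  (unscheduled⇒remaining U e k (λ s 1≤s s≤k → unsch s 1≤s (m≤n⇒m≤1+n s≤k)) ,
   x∉p⇒x∈∁p (unsch (suc k) (s≤s z≤n) ≤-refl))

scheduledOrNot : ∀ {N} (U : ℕ → Subset N) e k →
  Σ ℕ (λ t → 1 ≤ t × t ≤ k × e ∈ U t) ⊎ Unscheduled U e k
scheduledOrNot U e k with anyUpTo? (λ s → e ∈? U (suc s)) k
... | yes (s , s<k , e∈) = inj₁ (suc s , s≤s z≤n , s<k , e∈)
... | no none = inj₂ λ { (suc s) _ s<k e∈ → none (s , s<k , e∈) }

module Run {n N : ℕ} (E : Hypergraph n N) (r : Fin N → ℕ) (U : ℕ → Subset N)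
           (T : ℕ) (valid : ValidRunUpTo E r U T) where

  scheduled⇒available : ∀ t e → 1 ≤ t → t ≤ T → e ∈ U t → e ∈ Available r U t
  scheduled⇒available t e 1≤t t≤T = proj₁ (valid t 1≤t t≤T) e

  scheduled⇒released : ∀ t e → 1 ≤ t → t ≤ T → e ∈ U t → r e < t
  scheduled⇒released t e 1≤t t≤T e∈ = released⁻ r t e
    (proj₂ (x∈p∩q⁻ (Remaining U (pred t)) _ (scheduled⇒available t e 1≤t t≤T e∈)))

  removed-after-scheduled : ∀ s t e → 1 ≤ s → s < t → t ≤ T → e ∈ U s → e ∉ U t
  removed-after-scheduled s t e 1≤s s<t t≤T e∈s e∈t =
    remaining⇒unscheduled U e (pred t) present s 1≤s (<⇒≤pred s<t) e∈s
    where
    present : e ∈ Remaining U (pred t)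
    present = proj₁ (x∈p∩q⁻ (Remaining U (pred t)) _
                (scheduled⇒available t e (≤-trans 1≤s (<⇒≤ s<t)) t≤T e∈t))

  scheduled-once : ∀ s t e → 1 ≤ s → 1 ≤ t → s ≤ T → t ≤ T →
                   e ∈ U s → e ∈ U t → s ≡ t
  scheduled-once s t e 1≤s 1≤t s≤T t≤T e∈s e∈t with <-cmp s t
  ... | tri< s<t _ _ = ⊥-elim (removed-after-scheduled s t e 1≤s s<t t≤T e∈s e∈t)
  ... | tri≈ _ s≡t _ = s≡t
  ... | tri> _ _ t<s = ⊥-elim (removed-after-scheduled t s e 1≤t t<s s≤T e∈t e∈s)

  -- hyperedges scheduled in the same slot are node-disjoint, because the
  -- slot's kernel is independent and O orients every pair sharing a node
  slot-disjoint : ∀ t → 1 ≤ t → t ≤ T → ∀ e e′ → e ∈ U t → e′ ∈ U t →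
                  e ≢ e′ → Empty (E e ∩ E e′)
  slot-disjoint t 1≤t t≤T e e′ e∈ e′∈ e≢e′ (x , x∈) with <-cmp (toℕ e) (toℕ e′)
  ... | tri< e<e′ _ _ =
    independent e′ e e′∈ e∈ (e<e′ , x , subst (x ∈_) (∩-comm (E e) (E e′)) x∈)
    where independent = proj₁ (proj₂ (valid t 1≤t t≤T))
  ... | tri≈ _ e≡e′ _ = e≢e′ (toℕ-injective e≡e′)
  ... | tri> _ _ e′<e = independent e e′ e∈ e′∈ (e′<e , x , x∈)
    where independent = proj₁ (proj₂ (valid t 1≤t t≤T))

  remainingOut : Fin N → ℕ → Subset N
  remainingOut e k = outNbrs E e ∩ Remaining U k

  -- If e is present and released at slot k+1 but not chosen, the kernel
  -- contains an out-neighbour of e, which is then removed.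
  remainingOut-shrinks : ∀ e k → suc k ≤ T → e ∈ Available r U (suc k) →
    e ∉ U (suc k) → ∣ remainingOut e (suc k) ∣ < ∣ remainingOut e k ∣
  remainingOut-shrinks e k k<T e∈A e∉U with proj₂ (proj₂ kernelK) e e∈A e∉U
    where kernelK = valid (suc k) (s≤s z≤n) k<T
  ... | j , j∈U , arc = p⊂q⇒∣p∣<∣q∣ (smaller , j , j∈before , j∉after)
    where
    smaller : remainingOut e (suc k) ⊆ remainingOut e k
    smaller x∈ with x∈p∩q⁻ (outNbrs E e) _ x∈
    ... | out , rem = x∈p∩q⁺ (out , proj₁ (x∈p∩q⁻ (Remaining U k) _ rem))
    j∈before : j ∈ remainingOut e k
    j∈before = x∈p∩q⁺ (arc⇒outNbr E e j arc ,
      proj₁ (x∈p∩q⁻ (Remaining U k) _ (scheduled⇒available (suc k) j (s≤s z≤n) k<T j∈U)))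
    j∉after : j ∉ remainingOut e (suc k)
    j∉after j∈ = x∈∁p⇒x∉p
      (proj₂ (x∈p∩q⁻ (Remaining U k) _ (proj₂ (x∈p∩q⁻ (outNbrs E e) _ j∈)))) j∈U

  -- Each of the m slots after the release of an unscheduled e removes an
  -- out-neighbour of e.
  waiting-bound : ∀ e m → r e + m ≤ T → Unscheduled U e (r e + m) →
                  ∣ remainingOut e (r e + m) ∣ + m ≤ outdeg E e
  waiting-bound e 0 _ _ =
    ≤-trans (≤-reflexive (+-identityʳ _)) (∣p∩q∣≤∣p∣ (outNbrs E e) _)
  waiting-bound e (suc m) bound unsch rewrite +-suc (r e) m = begin
    ∣ remainingOut e (suc k) ∣ + suc m  ≡⟨ +-suc _ m ⟩
    suc ∣ remainingOut e (suc k) ∣ + m  ≤⟨ +-monoˡ-≤ m shrinks ⟩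
    ∣ remainingOut e k ∣ + m            ≤⟨ waiting-bound e m (≤-trans (n≤1+n k) bound) unsch-k ⟩
    outdeg E e                          ∎
    where
    open ≤-Reasoning
    k = r e + m
    unsch-k : Unscheduled U e k
    unsch-k s 1≤s s≤k = unsch s 1≤s (m≤n⇒m≤1+n s≤k)
    e∈A : e ∈ Available r U (suc k)
    e∈A = x∈p∩q⁺ (unscheduled⇒remaining U e k unsch-k ,
                  released⁺ r (suc k) e (s≤s (m≤m+n (r e) m)))
    shrinks = remainingOut-shrinks e k bound e∈A (unsch (suc k) (s≤s z≤n) ≤-refl)

  scheduled-within : ∀ e m → r e + m ≤ T → outdeg E e < m →
                     Σ ℕ (λ t → 1 ≤ t × t ≤ r e + m × e ∈ U t)
  scheduled-within e m bound outdeg<m with scheduledOrNot U e (r e + m)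
  ... | inj₁ found = found
  ... | inj₂ unsch =
    ⊥-elim (<⇒≱ outdeg<m (≤-trans (m≤n+m m _) (waiting-bound e m bound unsch)))

  ScheduledOnceBy : Fin N → ℕ → Set
  ScheduledOnceBy e d = Σ ℕ (λ t → (e ∈ U t) × (r e < t) × (t ≤ T) × (t ≤ d)
    × (∀ t′ → 1 ≤ t′ → t′ ≤ T → e ∈ U t′ → t′ ≡ t))

  scheduled-exactly-once : ∀ e m → r e + m ≤ T → outdeg E e < m →
                           ScheduledOnceBy e (r e + m)
  scheduled-exactly-once e m bound outdeg<m with scheduled-within e m bound outdeg<m
  ... | t , 1≤t , t≤r+m , e∈ =
    t , e∈ , scheduled⇒released t e 1≤t t≤T e∈ , t≤T , t≤r+m ,
    λ t′ 1≤t′ t′≤T e∈′ → scheduled-once t′ t e 1≤t′ 1≤t t′≤T t≤T e∈′ e∈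
    where t≤T = ≤-trans t≤r+m bound

lemma3 : (n N Λ : ℕ) (E : Hypergraph n N) (r D : Fin N → ℕ) →
    1 ≤ Λ →
    (∀ e → ∣ E e ∣ ≤ Λ) →
    (∀ i j → toℕ i ≤ toℕ j → D i ≤ D j) →
    (∀ e → outdeg E e + Λ ≤ Λ * D e) →
    let T = maxF r + Λ * maxF D in
    ((k : ℕ) → k < T → (U : ℕ → Subset N) → ValidRunUpTo E r U k →
    Σ (Subset N) (λ K → IsKernel E (Available r U (1 + k)) K))
    ×
    ((U : ℕ → Subset N) → ValidRunUpTo E r U T →
    (∀ e → Σ ℕ (λ t → (e ∈ U t) × (r e < t) × (t ≤ T) × (t ≤ r e + Λ * D e)
    × (∀ t′ → 1 ≤ t′ → t′ ≤ T → e ∈ U t′ → t′ ≡ t)))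
    ×
    (∀ t → 1 ≤ t → t ≤ T → ∀ e e′ → e ∈ U t → e′ ∈ U t → e ≢ e′ → Empty (E e ∩ E e′)))
lemma3 n N Λ E r D 1≤Λ _ _ degree-bound =
  (λ k _ U _ → kernelExists E (Available r U (1 + k))) ,
  (λ U valid →
    (λ e → Run.scheduled-exactly-once E r U T valid e (Λ * D e) (deadline≤T e) (outdeg<ΛD e)) ,
    Run.slot-disjoint E r U T valid)
  where
  T = maxF r + Λ * maxF D
  deadline≤T : ∀ e → r e + Λ * D e ≤ T
  deadline≤T e = +-mono-≤ (f≤maxF r e) (*-monoʳ-≤ Λ (f≤maxF D e))
  outdeg<ΛD : ∀ e → outdeg E e < Λ * D e
  outdeg<ΛD e = ≤-trans (m<m+n (outdeg E e) 1≤Λ) (degree-bound e)
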